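{- Let $p$ be an odd prime and $G\cong \mathbb{Z}_p\oplus\mathbb{Z}_2\oplus\mathbb{Z}_4$. Then there exists an MRS$^*_G(p,4;2)$.
   Context: $\mathbb{Z}_v$ denotes the additive group of integers modulo $v$. For a finite abelian group $(G,+)$ of order $xyz$, an MRS$^*_G(x,y;z)$ is a collection of $z$ arrays of size $x\times y$ whose entries are elements of $G$, each element of $G$ appearing exactly once among all the arrays, such that every row sum and every column sum in every array equals $0$. -}

module Defs where

open import Data.Nat using (ℕ; zero; suc; _+_; NonZero)
open import Data.Nat.DivMod using (_mod_)
open import Data.Fin using (Fin; toℕ)
open import Data.Product using (_×_; _,_)
open import Data.Vec.Functional using (foldr)
open import Relation.Binary.PropositionalEquality using (_≡_)
open import Function.Definitions using (Bijective)

_+ₙ_ : ∀ {n} → Fin n → Fin n → Fin n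
_+ₙ_ {suc m} a b = (toℕ a + toℕ b) mod (suc m)

G : ℕ → Set
G p = Fin p × Fin 2 × Fin 4

_⊕_ : ∀ {p} → G p → G p → G p
(a , b , c) ⊕ (a' , b' , c') = (a +ₙ a') , (b +ₙ b') , (c +ₙ c')

0G : ∀ p → .{{NonZero p}} → G p
0G p = (0 mod p) , Fin.zero , Fin.zero

ΣG : ∀ p → .{{NonZero p}} → ∀ {k} → (Fin k → G p) → G p
ΣG p f = foldr _⊕_ (0G p) f

record MRS* (p : ℕ) .{{_ : NonZero p}} (x y z : ℕ) : Set where
  field
    A         : Fin z → Fin x → Fin y → G p
    bijective : Bijective _≡_ _≡_ (λ (t : Fin z × Fin x × Fin y) →
                  let (k , i , j) = t in A k i j)
    rowSums   : ∀ k i → ΣG p (λ j → A k i j) ≡ 0G p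
    colSums   : ∀ k j → ΣG p (λ i → A k i j) ≡ 0G p

-- Write p = 5 + 2m (p = 3 is an explicit pair of arrays).  Entry (i, j) of array k is (±i, h)
-- with +i in columns 0, 1 and −i in columns 2, 3, so the ℤ_p-parts of each row cancel and those
-- of each column add up to ±Σ_{x ∈ ℤ_p} x = 0, p being odd.  The ℤ₂⊕ℤ₄-part h is row k of one of
-- seven 2×4 blocks, selected by a label of i: Z for 0, A₁, A₂ for 1, 2, B₂, B₁ for −2, −1, and
-- C, D alternately in between, so that −i carries the flipped label.  Block rows sum to 0, the
-- blocks C and D cancel, and Z, A₁, A₂, B₂, B₁ sum to 0, so all column sums vanish.  The entries
-- with ℤ_p-part x are those in columns 0, 1 of row x and in columns 2, 3 of row −x; their
-- ℤ₂⊕ℤ₄-parts are the left half of block c and the right half of block (flip c), where c is the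
-- label of x, and for every c these eight elements exhaust ℤ₂⊕ℤ₄.

{-# OPTIONS --safe #-}
module Submission where

open import Defs
open import Data.Nat using (ℕ; NonZero)
open import Data.Nat.Divisibility using (_∣_)
open import Data.Nat.Primality using (Prime)
open import Relation.Nullary using (¬_)

open import Algebra.Bundles using (CommutativeMonoid)
open import Algebra.Structures using (IsCommutativeMonoid)
open import Algebra.Structures.Biased using (isCommutativeMonoidˡ)
import Algebra.Properties.Monoid.Sum
import Algebra.Properties.CommutativeMonoid.Sum
import Algebra.Properties.CommutativeSemigroup
import Algebra.Solver.CommutativeMonoid
open import Data.Fin.Base using (Fin; zero; suc; toℕ; opposite)
open import Data.Fin.Patterns using (0F; 1F; 2F; 3F)
open import Data.Fin.Properties using (toℕ-injective; toℕ-fromℕ<; toℕ<n; opposite-prop; opposite-involutive)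
import Data.Fin.Properties as Fin
open import Data.Nat.Base using (zero; suc; _+_; _*_; _∸_; _%_; _<_; z≤n; s≤s; s≤s⁻¹)
open import Data.Nat.DivMod using (_mod_; %-distribˡ-+; m%n%n≡m%n; m<n⇒m%n≡m; n%n≡0; m*n%n≡0)
open import Data.Nat.Divisibility using (divides; ∣-refl; ∣m∣n⇒∣m+n)
open import Data.Nat.Primality using (¬prime[1])
open import Data.Nat.Properties using (+-comm; +-assoc; +-suc; +-commutativeSemigroup; suc-injective; m≤m+n; m≤n+m; +-0-monoid; m∸n+n≡m; m+[n∸m]≡n)
open import Data.Nat.Tactic.RingSolver using (solve-∀)
open import Data.Product using (∃; ∃-syntax; _×_; _,_; proj₁; proj₂)
import Data.Product.Properties as Product
open import Data.Vec.Functional using (foldr; []; _∷_)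
open import Function.Base using (_∘_)
open import Function.Consequences.Propositional using (strictlySurjective⇒surjective)
open import Function.Definitions using (Injective; Surjective; StrictlySurjective; Bijective)
open import Level using (0ℓ)
open import Relation.Binary.Definitions using (DecidableEquality)
open import Relation.Binary.PropositionalEquality
open import Relation.Binary.PropositionalEquality.Algebra using (isMagma)
open import Relation.Nullary.Decidable using (Dec; map′; from-yes; _×-dec_; _→-dec_)
open import Relation.Nullary.Negation using (contradiction)
open import Relation.Unary using (Pred; Decidable)

[m%d+n]%d≡[m+n]%d : ∀ m n d .{{_ : NonZero d}} → (m % d + n) % d ≡ (m + n) % d
[m%d+n]%d≡[m+n]%d m n d = begin
  (m % d + n) % d           ≡⟨ %-distribˡ-+ (m % d) n d ⟩
  (m % d % d + n % d) % d   ≡⟨ cong (λ x → (x + n % d) % d) (m%n%n≡m%n m d) ⟩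
  (m % d + n % d) % d       ≡⟨ %-distribˡ-+ m n d ⟨
  (m + n) % d               ∎
  where open ≡-Reasoning

[m+n%d]%d≡[m+n]%d : ∀ m n d .{{_ : NonZero d}} → (m + n % d) % d ≡ (m + n) % d
[m+n%d]%d≡[m+n]%d m n d = begin
  (m + n % d) % d ≡⟨ cong (_% d) (+-comm m (n % d)) ⟩
  (n % d + m) % d ≡⟨ [m%d+n]%d≡[m+n]%d n m d ⟩
  (n + m) % d     ≡⟨ cong (_% d) (+-comm n m) ⟩
  (m + n) % d     ∎
  where open ≡-Reasoning

module _ {n : ℕ} where

  toℕ-+ₙ : (a b : Fin (suc n)) → toℕ (a +ₙ b) ≡ (toℕ a + toℕ b) % suc n
  toℕ-+ₙ a b = toℕ-fromℕ< _

  +ₙ-comm : (a b : Fin (suc n)) → a +ₙ b ≡ b +ₙ a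
  +ₙ-comm a b = cong (_mod suc n) (+-comm (toℕ a) (toℕ b))

  +ₙ-assoc : (a b c : Fin (suc n)) → (a +ₙ b) +ₙ c ≡ a +ₙ (b +ₙ c)
  +ₙ-assoc a b c = toℕ-injective (begin
    toℕ ((a +ₙ b) +ₙ c)            ≡⟨ toℕ-+ₙ (a +ₙ b) c ⟩
    (toℕ (a +ₙ b) + z) % suc n     ≡⟨ cong (λ v → (v + z) % suc n) (toℕ-+ₙ a b) ⟩
    ((x + y) % suc n + z) % suc n  ≡⟨ [m%d+n]%d≡[m+n]%d (x + y) z (suc n) ⟩
    (x + y + z) % suc n            ≡⟨ cong (_% suc n) (+-assoc x y z) ⟩
    (x + (y + z)) % suc n          ≡⟨ [m+n%d]%d≡[m+n]%d x (y + z) (suc n) ⟨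
    (x + (y + z) % suc n) % suc n  ≡⟨ cong (λ v → (x + v) % suc n) (toℕ-+ₙ b c) ⟨
    (x + toℕ (b +ₙ c)) % suc n     ≡⟨ toℕ-+ₙ a (b +ₙ c) ⟨
    toℕ (a +ₙ (b +ₙ c))            ∎)
    where
    open ≡-Reasoning
    x = toℕ a
    y = toℕ b
    z = toℕ c

  +ₙ-identityˡ : (a : Fin (suc n)) → zero +ₙ a ≡ a
  +ₙ-identityˡ a = toℕ-injective (trans (toℕ-+ₙ zero a) (m<n⇒m%n≡m (toℕ<n a)))

  -ₙ_ : Fin (suc n) → Fin (suc n)
  -ₙ zero  = zero
  -ₙ suc i = suc (opposite i)

  -ₙ-involutive : (a : Fin (suc n)) → -ₙ (-ₙ a) ≡ a
  -ₙ-involutive zero    = refl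
  -ₙ-involutive (suc i) = cong suc (opposite-involutive i)

  +ₙ-inverseʳ : (a : Fin (suc n)) → a +ₙ (-ₙ a) ≡ zero
  +ₙ-inverseʳ zero    = refl
  +ₙ-inverseʳ (suc i) = toℕ-injective (begin
    toℕ (suc i +ₙ (-ₙ suc i))                      ≡⟨ toℕ-+ₙ (suc i) (-ₙ suc i) ⟩
    (suc (toℕ i) + suc (toℕ (opposite i))) % suc n ≡⟨ cong (λ x → (suc (toℕ i) + suc x) % suc n) (opposite-prop i) ⟩
    (suc (toℕ i) + suc (n ∸ suc (toℕ i))) % suc n  ≡⟨ cong (_% suc n) (+-comm (suc (toℕ i)) _) ⟩
    (suc (n ∸ suc (toℕ i)) + suc (toℕ i)) % suc n  ≡⟨ cong (λ x → suc x % suc n) (m∸n+n≡m (toℕ<n i)) ⟩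
    suc n % suc n                                  ≡⟨ n%n≡0 (suc n) ⟩
    0                                              ∎)
    where open ≡-Reasoning

+ₙ-0-isCommutativeMonoid : ∀ n → IsCommutativeMonoid _≡_ (_+ₙ_ {suc n}) zero
+ₙ-0-isCommutativeMonoid n = isCommutativeMonoidˡ record
  { isSemigroup = record { isMagma = isMagma _+ₙ_ ; assoc = +ₙ-assoc }
  ; identityˡ   = +ₙ-identityˡ
  ; comm        = +ₙ-comm
  }

+ₙ-0-commutativeMonoid : ℕ → CommutativeMonoid 0ℓ 0ℓ
+ₙ-0-commutativeMonoid n = record { isCommutativeMonoid = +ₙ-0-isCommutativeMonoid n }

module ℕSum where
  open Algebra.Properties.Monoid.Sum +-0-monoid public
  open Algebra.Properties.CommutativeSemigroup +-commutativeSemigroup using (x∙yz≈y∙xz)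

  sum-suc : ∀ {k} (f : Fin k → ℕ) → sum (suc ∘ f) ≡ k + sum f
  sum-suc {zero}  f = refl
  sum-suc {suc k} f = begin
    suc (f zero + sum (suc ∘ f ∘ suc)) ≡⟨ cong (λ x → suc (f zero + x)) (sum-suc (f ∘ suc)) ⟩
    suc (f zero + (k + sum (f ∘ suc))) ≡⟨ cong suc (x∙yz≈y∙xz (f zero) k (sum (f ∘ suc))) ⟩
    suc (k + (f zero + sum (f ∘ suc))) ∎
    where open ≡-Reasoning

  sum-toℕ-odd : ∀ h → sum {suc (h * 2)} toℕ ≡ h * suc (h * 2)
  sum-toℕ-odd zero    = refl
  sum-toℕ-odd (suc h) = begin
    sum {3 + h * 2} toℕ                                ≡⟨ sum-suc {2 + h * 2} toℕ ⟩
    (2 + h * 2) + sum {2 + h * 2} toℕ                  ≡⟨ cong ((2 + h * 2) +_) (sum-suc {1 + h * 2} toℕ) ⟩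
    (2 + h * 2) + ((1 + h * 2) + sum {1 + h * 2} toℕ)  ≡⟨ cong (λ x → (2 + h * 2) + ((1 + h * 2) + x)) (sum-toℕ-odd h) ⟩
    (2 + h * 2) + ((1 + h * 2) + h * (1 + h * 2))      ≡⟨ step h ⟩
    suc h * (3 + h * 2)                                ∎
    where
    open ≡-Reasoning
    step : ∀ h → (2 + h * 2) + ((1 + h * 2) + h * (1 + h * 2)) ≡ suc h * (3 + h * 2)
    step = solve-∀

module ℤₙ {n : ℕ} where
  open Algebra.Properties.CommutativeMonoid.Sum (+ₙ-0-commutativeMonoid n) public
  open Algebra.Solver.CommutativeMonoid (+ₙ-0-commutativeMonoid n) using (solve; _⊜_) renaming (_⊕_ to _⊞_; id to ∅)

  toℕ-sum : ∀ {k} (f : Fin k → Fin (suc n)) → toℕ (sum f) ≡ ℕSum.sum (toℕ ∘ f) % suc n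
  toℕ-sum {zero}  f = refl
  toℕ-sum {suc k} f = begin
    toℕ (f zero +ₙ sum (f ∘ suc))                             ≡⟨ toℕ-+ₙ (f zero) _ ⟩
    (toℕ (f zero) + toℕ (sum (f ∘ suc))) % suc n              ≡⟨ cong (λ x → (toℕ (f zero) + x) % suc n) (toℕ-sum (f ∘ suc)) ⟩
    (toℕ (f zero) + ℕSum.sum (toℕ ∘ f ∘ suc) % suc n) % suc n ≡⟨ [m+n%d]%d≡[m+n]%d (toℕ (f zero)) _ (suc n) ⟩
    ℕSum.sum (toℕ ∘ f) % suc n                                ∎
    where open ≡-Reasoning

  sum-negate : ∀ {k} (f : Fin k → Fin (suc n)) → sum f ≡ zero → sum (-ₙ_ ∘ f) ≡ zero
  sum-negate {k} f ∑f≡0 = begin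
    sum (-ₙ_ ∘ f)               ≡⟨ +ₙ-identityˡ _ ⟨
    zero +ₙ sum (-ₙ_ ∘ f)       ≡⟨ cong (_+ₙ sum (-ₙ_ ∘ f)) ∑f≡0 ⟨
    sum f +ₙ sum (-ₙ_ ∘ f)      ≡⟨ ∑-distrib-+ f (-ₙ_ ∘ f) ⟨
    sum (λ i → f i +ₙ (-ₙ f i)) ≡⟨ sum-cong-≗ (+ₙ-inverseʳ ∘ f) ⟩
    sum {k} (λ _ → zero)        ≡⟨ sum-replicate-zero k ⟩
    zero                        ∎
    where open ≡-Reasoning

  a+a+-a+-a≡0 : (a : Fin (suc n)) → a +ₙ (a +ₙ ((-ₙ a) +ₙ ((-ₙ a) +ₙ zero))) ≡ zero
  a+a+-a+-a≡0 a = begin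
    a +ₙ (a +ₙ ((-ₙ a) +ₙ ((-ₙ a) +ₙ zero))) ≡⟨ solve 2 (λ x y → x ⊞ (x ⊞ (y ⊞ (y ⊞ ∅))) ⊜ (x ⊞ y) ⊞ (x ⊞ y)) refl a (-ₙ a) ⟩
    (a +ₙ (-ₙ a)) +ₙ (a +ₙ (-ₙ a))          ≡⟨ cong₂ _+ₙ_ (+ₙ-inverseʳ a) (+ₙ-inverseʳ a) ⟩
    zero                                    ∎
    where open ≡-Reasoning

sum-id≡0-odd : ∀ h → ℤₙ.sum {h * 2} {suc (h * 2)} (λ i → i) ≡ zero
sum-id≡0-odd h = toℕ-injective (begin
  toℕ (ℤₙ.sum {h * 2} (λ i → i))          ≡⟨ ℤₙ.toℕ-sum {h * 2} (λ i → i) ⟩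
  ℕSum.sum {suc (h * 2)} toℕ % suc (h * 2) ≡⟨ cong (_% suc (h * 2)) (ℕSum.sum-toℕ-odd h) ⟩
  h * suc (h * 2) % suc (h * 2)            ≡⟨ m*n%n≡0 h (suc (h * 2)) ⟩
  0                                        ∎)
  where open ≡-Reasoning

2∤n⇒n≡1+h*2 : ∀ n → ¬ 2 ∣ n → ∃[ h ] n ≡ suc (h * 2)
2∤n⇒n≡1+h*2 zero          2∤n = contradiction (divides 0 refl) 2∤n
2∤n⇒n≡1+h*2 (suc zero)    _   = 0 , refl
2∤n⇒n≡1+h*2 (suc (suc n)) 2∤n with h , refl ← 2∤n⇒n≡1+h*2 n (2∤n ∘ ∣m∣n⇒∣m+n ∣-refl) = suc h , refl

record Searchable (A : Set) : Set₁ where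
  infix 4 _≟_
  field
    _≟_ : DecidableEquality A
    ∀? : {P : Pred A 0ℓ} → Decidable P → Dec (∀ x → P x)
    ∃? : {P : Pred A 0ℓ} → Decidable P → Dec (∃ P)

Fin-searchable : ∀ {n} → Searchable (Fin n)
Fin-searchable = record { _≟_ = Fin._≟_ ; ∀? = Fin.all? ; ∃? = Fin.any? }

×-searchable : ∀ {A B} → Searchable A → Searchable B → Searchable (A × B)
×-searchable SA SB = record
  { _≟_ = Product.≡-dec A._≟_ B._≟_
  ; ∀?  = λ P? → map′ (λ h (a , b) → h a b) (λ h a b → h (a , b)) (A.∀? λ a → B.∀? λ b → P? (a , b))
  ; ∃?  = λ P? → map′ (λ (a , b , pab) → (a , b) , pab) (λ ((a , b) , pab) → a , b , pab)
                      (A.∃? λ a → B.∃? λ b → P? (a , b))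
  }
  where
  module A = Searchable SA
  module B = Searchable SB

bijective? : ∀ {A B} → Searchable A → Searchable B → (f : A → B) → Dec (Bijective _≡_ _≡_ f)
bijective? SA SB f = injective? ×-dec surjective?
  where
  open Searchable
  injective? : Dec (Injective _≡_ _≡_ f)
  injective? = map′ (λ h → h _ _) (λ h _ _ → h)
                    (∀? SA λ x → ∀? SA λ y → _≟_ SB (f x) (f y) →-dec _≟_ SA x y)
  surjective? : Dec (Surjective _≡_ _≡_ f)
  surjective? = map′ strictlySurjective⇒surjective (λ h y → proj₁ (h y) , proj₂ (h y) refl)
                     (∀? SB λ y → ∃? SA λ x → _≟_ SB (f x) y)

module Twisted
  {K J R L B : Set}
  (σ : J → R → R) (σ-involutive : ∀ j r → σ j (σ j r) ≡ r)
  (ℓ : R → L) (τ : J → L → L) (ℓ∘σ≡τ∘ℓ : ∀ j r → ℓ (σ j r) ≡ τ j (ℓ r))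
  (w : L → K → J → B)
  (w-bijective : ∀ c → Bijective _≡_ _≡_ (λ ((k , j) : K × J) → w (τ j c) k j))
  where

  twisted : K × R × J → R × B
  twisted (k , r , j) = σ j r , w (ℓ r) k j

  private
    ℓ≡τ∘ℓ∘σ : ∀ j r → ℓ r ≡ τ j (ℓ (σ j r))
    ℓ≡τ∘ℓ∘σ j r = trans (cong ℓ (sym (σ-involutive j r))) (ℓ∘σ≡τ∘ℓ j (σ j r))

    σ-injective : ∀ j {r r′} → σ j r ≡ σ j r′ → r ≡ r′
    σ-injective j {r} {r′} eq = trans (sym (σ-involutive j r)) (trans (cong (σ j) eq) (σ-involutive j r′))

    same-cell : ∀ {k r j k′ r′ j′} → twisted (k , r , j) ≡ twisted (k′ , r′ , j′) → (k , j) ≡ (k′ , j′)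
    same-cell {k} {r} {j} {k′} {r′} {j′} eq = proj₁ (w-bijective c) (begin
      w (τ j c) k j                 ≡⟨ cong (λ x → w x k j) (ℓ≡τ∘ℓ∘σ j r) ⟨
      w (ℓ r) k j                   ≡⟨ cong proj₂ eq ⟩
      w (ℓ r′) k′ j′                ≡⟨ cong (λ x → w x k′ j′) (ℓ≡τ∘ℓ∘σ j′ r′) ⟩
      w (τ j′ (ℓ (σ j′ r′))) k′ j′  ≡⟨ cong (λ x → w (τ j′ (ℓ x)) k′ j′) (cong proj₁ eq) ⟨
      w (τ j′ c) k′ j′              ∎)
      where
      open ≡-Reasoning
      c = ℓ (σ j r)

  twisted-injective : Injective _≡_ _≡_ twisted
  twisted-injective {k , r , j} {_ , r′ , _} eq with refl ← same-cell eq =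
    cong (λ x → k , x , j) (σ-injective j (cong proj₁ eq))

  twisted-surjective : StrictlySurjective _≡_ twisted
  twisted-surjective (v , b) = (k , σ j v , j) , cong₂ _,_ (σ-involutive j v) (begin
    w (ℓ (σ j v)) k j  ≡⟨ cong (λ x → w x k j) (ℓ∘σ≡τ∘ℓ j v) ⟩
    w (τ j (ℓ v)) k j  ≡⟨ proj₂ (proj₂ (w-bijective (ℓ v)) b) refl ⟩
    b                  ∎)
    where
    open ≡-Reasoning
    k = proj₁ (proj₁ (proj₂ (w-bijective (ℓ v)) b))
    j = proj₂ (proj₁ (proj₂ (w-bijective (ℓ v)) b))

  twisted-bijective : Bijective _≡_ _≡_ twisted
  twisted-bijective = twisted-injective , strictlySurjective⇒surjective twisted-surjective

H : Set
H = Fin 2 × Fin 4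

infixr 5 _⊕H_

_⊕H_ : H → H → H
(b , c) ⊕H (b′ , c′) = b +ₙ b′ , c +ₙ c′

0H : H
0H = zero , zero

ΣH : ∀ {k} → (Fin k → H) → H
ΣH = foldr _⊕H_ 0H

H-searchable : Searchable H
H-searchable = ×-searchable Fin-searchable Fin-searchable

open Searchable H-searchable using () renaming (_≟_ to _≟H_)

⊕H-cancel : ∀ x y → x ⊕H y ≡ 0H → ∀ z → x ⊕H (y ⊕H z) ≡ z
⊕H-cancel (a , b) (a′ , b′) x⊕y≡0 (a″ , b″) = begin
  a +ₙ (a′ +ₙ a″) , b +ₙ (b′ +ₙ b″)  ≡⟨ cong₂ _,_ (+ₙ-assoc a a′ a″) (+ₙ-assoc b b′ b″) ⟨
  (a +ₙ a′) +ₙ a″ , (b +ₙ b′) +ₙ b″  ≡⟨ cong (λ (x , y) → x +ₙ a″ , y +ₙ b″) x⊕y≡0 ⟩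
  zero +ₙ a″ , zero +ₙ b″            ≡⟨ cong₂ _,_ (+ₙ-identityˡ a″) (+ₙ-identityˡ b″) ⟩
  a″ , b″                            ∎
  where open ≡-Reasoning

ΣG-split : ∀ {q k} (f : Fin k → G (suc q)) → ΣG (suc q) f ≡ (ℤₙ.sum (proj₁ ∘ f) , ΣH (proj₂ ∘ f))
ΣG-split {k = zero}  f = refl
ΣG-split {k = suc k} f = cong (f zero ⊕_) (ΣG-split (f ∘ suc))

data Label : Set where
  Z A₁ A₂ B₂ B₁ C D : Label

flip : Label → Label
flip Z  = Z
flip A₁ = B₁
flip B₁ = A₁
flip A₂ = B₂
flip B₂ = A₂
flip C  = D
flip D  = C

flip-involutive : ∀ c → flip (flip c) ≡ c
flip-involutive Z  = refl
flip-involutive A₁ = refl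
flip-involutive A₂ = refl
flip-involutive B₂ = refl
flip-involutive B₁ = refl
flip-involutive C  = refl
flip-involutive D  = refl

all-labels? : {P : Pred Label 0ℓ} → Decidable P → Dec (∀ c → P c)
all-labels? P? = map′
  (λ (z , a₁ , a₂ , b₂ , b₁ , c , d) → λ { Z → z ; A₁ → a₁ ; A₂ → a₂ ; B₂ → b₂ ; B₁ → b₁ ; C → c ; D → d })
  (λ h → h Z , h A₁ , h A₂ , h B₂ , h B₁ , h C , h D)
  (P? Z ×-dec P? A₁ ×-dec P? A₂ ×-dec P? B₂ ×-dec P? B₁ ×-dec P? C ×-dec P? D)

onRight : {A : Set} → (A → A) → Fin 4 → A → A
onRight f 0F = λ x → x
onRight f 1F = λ x → x
onRight f 2F = f
onRight f 3F = f

onRight-involutive : {A : Set} {f : A → A} → (∀ x → f (f x) ≡ x) → ∀ j x → onRight f j (onRight f j x) ≡ x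
onRight-involutive f-inv 0F x = refl
onRight-involutive f-inv 1F x = refl
onRight-involutive f-inv 2F x = f-inv x
onRight-involutive f-inv 3F x = f-inv x

block : Label → Fin 2 → Fin 4 → H
block Z  = ((0F , 2F) ∷ (0F , 3F) ∷ (1F , 1F) ∷ (1F , 2F) ∷ [])
         ∷ ((0F , 1F) ∷ (0F , 0F) ∷ (1F , 3F) ∷ (1F , 0F) ∷ []) ∷ []
block A₁ = ((0F , 2F) ∷ (1F , 0F) ∷ (0F , 3F) ∷ (1F , 3F) ∷ [])
         ∷ ((0F , 1F) ∷ (1F , 2F) ∷ (1F , 1F) ∷ (0F , 0F) ∷ []) ∷ []
block A₂ = ((0F , 2F) ∷ (0F , 3F) ∷ (1F , 2F) ∷ (1F , 1F) ∷ [])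
         ∷ ((0F , 1F) ∷ (0F , 0F) ∷ (1F , 0F) ∷ (1F , 3F) ∷ []) ∷ []
block B₂ = ((0F , 1F) ∷ (0F , 2F) ∷ (1F , 3F) ∷ (1F , 2F) ∷ [])
         ∷ ((0F , 3F) ∷ (0F , 0F) ∷ (1F , 1F) ∷ (1F , 0F) ∷ []) ∷ []
block B₁ = ((0F , 1F) ∷ (1F , 0F) ∷ (1F , 3F) ∷ (0F , 0F) ∷ [])
         ∷ ((0F , 2F) ∷ (1F , 2F) ∷ (0F , 3F) ∷ (1F , 1F) ∷ []) ∷ []
block C  = ((0F , 0F) ∷ (0F , 1F) ∷ (1F , 0F) ∷ (1F , 3F) ∷ [])
         ∷ ((0F , 2F) ∷ (0F , 3F) ∷ (1F , 1F) ∷ (1F , 2F) ∷ []) ∷ []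
block D  = ((0F , 0F) ∷ (0F , 3F) ∷ (1F , 0F) ∷ (1F , 1F) ∷ [])
         ∷ ((0F , 2F) ∷ (0F , 1F) ∷ (1F , 3F) ∷ (1F , 2F) ∷ []) ∷ []

block-rowSum : ∀ c k → ΣH (block c k) ≡ 0H
block-rowSum = from-yes (all-labels? λ c → Fin.all? λ k → ΣH (block c k) ≟H 0H)

block-colSum : ∀ k j →
  block Z k j ⊕H block A₁ k j ⊕H block A₂ k j ⊕H block B₂ k j ⊕H block B₁ k j ⊕H 0H ≡ 0H
block-colSum = from-yes (Fin.all? λ k → Fin.all? λ j →
  block Z k j ⊕H block A₁ k j ⊕H block A₂ k j ⊕H block B₂ k j ⊕H block B₁ k j ⊕H 0H ≟H 0H)

block-C⊕D : ∀ k j → block C k j ⊕H block D k j ≡ 0H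
block-C⊕D = from-yes (Fin.all? λ k → Fin.all? λ j → block C k j ⊕H block D k j ≟H 0H)

block-bijective : ∀ c → Bijective _≡_ _≡_ (λ ((k , j) : Fin 2 × Fin 4) → block (onRight flip j c) k j)
block-bijective = from-yes (all-labels? λ c →
  bijective? H-searchable H-searchable (λ (k , j) → block (onRight flip j c) k j))

alternating : ℕ → Label
alternating zero          = C
alternating (suc zero)    = D
alternating (suc (suc u)) = alternating u

alternating-suc : ∀ u → alternating (suc u) ≡ flip (alternating u)
alternating-suc zero          = refl
alternating-suc (suc zero)    = refl
alternating-suc (suc (suc u)) = alternating-suc u

alternating-odd : ∀ m → alternating (suc (m * 2)) ≡ D
alternating-odd zero    = refl
alternating-odd (suc m) = alternating-odd m

alternating-mirror : ∀ m u u′ → suc (u + u′) ≡ m * 2 → alternating u′ ≡ flip (alternating u)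
alternating-mirror (suc m) zero     u′ refl = alternating-odd m
alternating-mirror m       (suc u)  u′ eq   = begin
  alternating u′               ≡⟨ flip-involutive _ ⟨
  flip (flip (alternating u′)) ≡⟨ cong flip (alternating-suc u′) ⟨
  flip (alternating (suc u′))  ≡⟨ cong flip (alternating-mirror m u (suc u′) (trans (cong suc (+-suc u u′)) eq)) ⟩
  flip (flip (alternating u))  ≡⟨ cong flip (alternating-suc u) ⟨
  flip (alternating (suc u))   ∎
  where open ≡-Reasoning

tailLabel : ℕ → ℕ → Label
tailLabel zero    zero          = B₂
tailLabel zero    (suc _)       = B₁
tailLabel (suc m) zero          = C
tailLabel (suc m) (suc zero)    = D
tailLabel (suc m) (suc (suc u)) = tailLabel m u

tailLabel-B₂ : ∀ m → tailLabel m (m * 2) ≡ B₂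
tailLabel-B₂ zero    = refl
tailLabel-B₂ (suc m) = tailLabel-B₂ m

tailLabel-B₁ : ∀ m → tailLabel m (suc (m * 2)) ≡ B₁
tailLabel-B₁ zero    = refl
tailLabel-B₁ (suc m) = tailLabel-B₁ m

tailLabel-alternating : ∀ m u → u < m * 2 → tailLabel m u ≡ alternating u
tailLabel-alternating (suc m) zero          _               = refl
tailLabel-alternating (suc m) (suc zero)    _               = refl
tailLabel-alternating (suc m) (suc (suc u)) (s≤s (s≤s u<)) = tailLabel-alternating m u u<

label : ℕ → ℕ → Label
label m zero                = Z
label m (suc zero)          = A₁
label m (suc (suc zero))    = A₂
label m (suc (suc (suc u))) = tailLabel m u

flip-swap : ∀ {a b} → a ≡ flip b → b ≡ flip a
flip-swap {a} {b} a≡flip-b = trans (sym (flip-involutive b)) (cong flip (sym a≡flip-b))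

tailLabel-mirror : ∀ m u u′ → suc (u + u′) ≡ m * 2 → tailLabel m u′ ≡ flip (tailLabel m u)
tailLabel-mirror m u u′ e = begin
  tailLabel m u′          ≡⟨ tailLabel-alternating m u′ (subst (u′ <_) e (s≤s (m≤n+m u′ u))) ⟩
  alternating u′          ≡⟨ alternating-mirror m u u′ e ⟩
  flip (alternating u)    ≡⟨ cong flip (tailLabel-alternating m u (subst (u <_) e (s≤s (m≤m+n u u′)))) ⟨
  flip (tailLabel m u)    ∎
  where open ≡-Reasoning

label-mirror-ends : ∀ m t t′ → t < 2 → t + t′ ≡ 3 + m * 2 → label m (suc t′) ≡ flip (label m (suc t))
label-mirror-ends m zero          _ _               refl = tailLabel-B₁ m
label-mirror-ends m (suc zero)    _ _               refl = tailLabel-B₂ m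
label-mirror-ends m (suc (suc _)) _ (s≤s (s≤s ())) _

label-mirror : ∀ m t t′ → t + t′ ≡ 3 + m * 2 → label m (suc t′) ≡ flip (label m (suc t))
label-mirror m zero          t′             eq = label-mirror-ends m 0 t′ (s≤s z≤n) eq
label-mirror m (suc zero)    t′             eq = label-mirror-ends m 1 t′ (s≤s (s≤s z≤n)) eq
label-mirror m (suc (suc u)) zero           eq =
  flip-swap (label-mirror-ends m 0 (suc (suc u)) (s≤s z≤n) (trans (+-comm 0 (suc (suc u))) eq))
label-mirror m (suc (suc u)) (suc zero)     eq =
  flip-swap (label-mirror-ends m 1 (suc (suc u)) (s≤s (s≤s z≤n)) (trans (+-comm 1 (suc (suc u))) eq))
label-mirror m (suc (suc u)) (suc (suc u′)) eq = tailLabel-mirror m u u′ (suc-injective (begin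
  suc (suc (u + u′)) ≡⟨ cong suc (+-suc u u′) ⟨
  suc (u + suc u′)   ≡⟨ +-suc u (suc u′) ⟨
  u + suc (suc u′)   ≡⟨ suc-injective (suc-injective eq) ⟩
  suc (m * 2)        ∎))
  where open ≡-Reasoning

label-negate : ∀ m (i : Fin (5 + m * 2)) → label m (toℕ (-ₙ i)) ≡ flip (label m (toℕ i))
label-negate m zero    = refl
label-negate m (suc r) = label-mirror m (toℕ r) (toℕ (opposite r)) (begin
  toℕ r + toℕ (opposite r)      ≡⟨ cong (toℕ r +_) (opposite-prop r) ⟩
  toℕ r + ((3 + m * 2) ∸ toℕ r) ≡⟨ m+[n∸m]≡n (s≤s⁻¹ (toℕ<n r)) ⟩
  3 + m * 2                     ∎)
  where open ≡-Reasoning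

tailLabel-sum : ∀ m (w : Label → H) → w C ⊕H w D ≡ 0H →
                ΣH {2 + m * 2} (λ i → w (tailLabel m (toℕ i))) ≡ w B₂ ⊕H w B₁ ⊕H 0H
tailLabel-sum zero    w _       = refl
tailLabel-sum (suc m) w C⊕D≡0 = trans (⊕H-cancel (w C) (w D) C⊕D≡0 _) (tailLabel-sum m w C⊕D≡0)

label-sum : ∀ m (w : Label → H) → w C ⊕H w D ≡ 0H →
            ΣH {5 + m * 2} (λ i → w (label m (toℕ i))) ≡ w Z ⊕H w A₁ ⊕H w A₂ ⊕H w B₂ ⊕H w B₁ ⊕H 0H
label-sum m w C⊕D≡0 = cong (λ x → w Z ⊕H w A₁ ⊕H w A₂ ⊕H x) (tailLabel-sum m w C⊕D≡0)

module OddConstruction (m : ℕ) where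

  p : ℕ
  p = 5 + m * 2

  rowLabel : Fin p → Label
  rowLabel i = label m (toℕ i)

  array : Fin 2 → Fin p → Fin 4 → G p
  array k i j = onRight -ₙ_ j i , block (rowLabel i) k j

  rowLabel-onRight : ∀ j i → rowLabel (onRight -ₙ_ j i) ≡ onRight flip j (rowLabel i)
  rowLabel-onRight 0F i = refl
  rowLabel-onRight 1F i = refl
  rowLabel-onRight 2F i = label-negate m i
  rowLabel-onRight 3F i = label-negate m i

  open Twisted (onRight -ₙ_) (onRight-involutive -ₙ-involutive) rowLabel (onRight flip) rowLabel-onRight
               block block-bijective

  rowSum : ∀ k i → ΣG p (λ j → array k i j) ≡ 0G p
  rowSum k i = cong₂ _,_ (ℤₙ.a+a+-a+-a≡0 i) (block-rowSum (rowLabel i) k)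

  columnSum-ℤ : ∀ j → ℤₙ.sum (λ (i : Fin p) → onRight -ₙ_ j i) ≡ zero
  columnSum-ℤ 0F = sum-id≡0-odd (2 + m)
  columnSum-ℤ 1F = sum-id≡0-odd (2 + m)
  columnSum-ℤ 2F = ℤₙ.sum-negate (λ i → i) (sum-id≡0-odd (2 + m))
  columnSum-ℤ 3F = ℤₙ.sum-negate (λ i → i) (sum-id≡0-odd (2 + m))

  columnSum : ∀ k j → ΣG p (λ i → array k i j) ≡ 0G p
  columnSum k j = trans (ΣG-split (λ i → array k i j)) (cong₂ _,_ (columnSum-ℤ j) (begin
    ΣH (λ i → block (rowLabel i) k j)
      ≡⟨ label-sum m (λ c → block c k j) (block-C⊕D k j) ⟩
    block Z k j ⊕H block A₁ k j ⊕H block A₂ k j ⊕H block B₂ k j ⊕H block B₁ k j ⊕H 0H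
      ≡⟨ block-colSum k j ⟩
    0H
      ∎))
    where open ≡-Reasoning

  mrs : MRS* p p 4 2
  mrs = record
    { A         = array
    ; bijective = twisted-bijective
    ; rowSums   = rowSum
    ; colSums   = columnSum
    }

array₃ : Fin 2 → Fin 3 → Fin 4 → G 3
array₃ = (((1F , 0F , 0F) ∷ (0F , 0F , 1F) ∷ (0F , 1F , 1F) ∷ (2F , 1F , 2F) ∷ [])
        ∷ ((2F , 1F , 1F) ∷ (1F , 1F , 0F) ∷ (1F , 1F , 3F) ∷ (2F , 1F , 0F) ∷ [])
        ∷ ((0F , 1F , 3F) ∷ (2F , 1F , 3F) ∷ (2F , 0F , 0F) ∷ (2F , 0F , 2F) ∷ []) ∷ [])
       ∷ (((0F , 0F , 2F) ∷ (1F , 0F , 2F) ∷ (1F , 0F , 1F) ∷ (1F , 0F , 3F) ∷ [])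
        ∷ ((0F , 1F , 0F) ∷ (2F , 0F , 3F) ∷ (1F , 1F , 1F) ∷ (0F , 0F , 0F) ∷ [])
        ∷ ((0F , 1F , 2F) ∷ (0F , 0F , 3F) ∷ (1F , 1F , 2F) ∷ (2F , 0F , 1F) ∷ []) ∷ []) ∷ []

mrs₃ : MRS* 3 3 4 2
mrs₃ = record
  { A         = array₃
  ; bijective = from-yes (bijective? (×-searchable Fin-searchable (×-searchable Fin-searchable Fin-searchable))
                                     G₃-searchable (λ (k , i , j) → array₃ k i j))
  ; rowSums   = from-yes (Fin.all? λ k → Fin.all? λ i → ΣG 3 (array₃ k i) ≟G₃ 0G 3)
  ; colSums   = from-yes (Fin.all? λ k → Fin.all? λ j → ΣG 3 (λ i → array₃ k i j) ≟G₃ 0G 3)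
  }
  where
  G₃-searchable : Searchable (G 3)
  G₃-searchable = ×-searchable Fin-searchable H-searchable
  open Searchable G₃-searchable using () renaming (_≟_ to _≟G₃_)

lemma3p3 : (p : ℕ) .{{_ : NonZero p}} → Prime p → ¬ (2 ∣ p) →
    MRS* p p 4 2
lemma3p3 p p-prime 2∤p with 2∤n⇒n≡1+h*2 p 2∤p
... | zero , refl        = contradiction p-prime ¬prime[1]
... | suc zero , refl    = mrs₃
... | suc (suc m) , refl = OddConstruction.mrs m
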